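{- There is a constant $c>0$ such that for every $n\ge1$ and all increasing $\mathcal{A},\mathcal{B}\subseteq\Omega=\{0,1\}^n$, $$\mathrm{Cor}(\mathcal{A},\mathcal{B})\ge c\sum_{S\neq\emptyset}\hat{\mathcal{A}}(S)^2\,\hat{\mathcal{B}}(S)^2.$$
   Context: Subsets of $[n]$ are identified with elements of $\Omega=\{0,1\}^n$; $\mu$ is the uniform probability measure. A family is increasing if closed under supersets. $\mathrm{Cor}(\mathcal{A},\mathcal{B})=\mu(\mathcal{A}\cap\mathcal{B})-\mu(\mathcal{A})\mu(\mathcal{B})$. For a family $\mathcal{C}$ and $S\subseteq[n]$, $\hat{\mathcal{C}}(S)=\mathbb{E}_\mu[1_{\mathcal{C}}\,u_S]$ where $u_S(T)=(-1)^{|S\cap T|}$. -}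

module Defs where

open import Data.Bool using (Bool; true; false; if_then_else_; _∧_; not)
open import Data.Nat using (ℕ; zero; suc)
open import Data.Integer using (+_)
open import Data.List using (List; []; _∷_; map; _++_; foldr)
open import Data.Vec using (Vec; []; _∷_)
open import Data.Rational using (ℚ; _+_; _*_; _-_; -_; _/_; 0ℚ; 1ℚ)
open import Relation.Binary.PropositionalEquality using (_≡_)

-- Ω = {0,1}^n : subsets of [n] as Boolean vectors (true = element present)
Ω : ℕ → Set
Ω n = Vec Bool n

Family : ℕ → Set
Family n = Ω n → Bool

allΩ : (n : ℕ) → List (Ω n)
allΩ zero = [] ∷ []
allΩ (suc n) = map (false ∷_) (allΩ n) ++ map (true ∷_) (allΩ n)

sumℚ : ∀ {A : Set} → List A → (A → ℚ) → ℚ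
sumℚ xs f = foldr (λ x acc → f x + acc) 0ℚ xs

half^ : ℕ → ℚ
half^ zero = 1ℚ
half^ (suc n) = (+ 1 / 2) * half^ n

𝔼 : (n : ℕ) → (Ω n → ℚ) → ℚ
𝔼 n f = half^ n * sumℚ (allΩ n) f

𝟙 : ∀ {n} → Family n → Ω n → ℚ
𝟙 C x = if C x then 1ℚ else 0ℚ

μ : (n : ℕ) → Family n → ℚ
μ n C = 𝔼 n (𝟙 C)

_∩_ : ∀ {n} → Family n → Family n → Family n
(A ∩ B) x = A x ∧ B x

Cor : (n : ℕ) → Family n → Family n → ℚ
Cor n A B = μ n (A ∩ B) - μ n A * μ n B

_⊆_ : ∀ {n} → Ω n → Ω n → Set
[] ⊆ [] = Data.Unit.⊤ where import Data.Unit
(false ∷ xs) ⊆ (_ ∷ ys) = xs ⊆ ys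
(true ∷ xs) ⊆ (true ∷ ys) = xs ⊆ ys
(true ∷ xs) ⊆ (false ∷ ys) = Data.Empty.⊥ where import Data.Empty

Increasing : ∀ {n} → Family n → Set
Increasing {n} C = (x y : Ω n) → x ⊆ y → C x ≡ true → C y ≡ true

oddInter : ∀ {n} → Ω n → Ω n → Bool
oddInter [] [] = false
oddInter (s ∷ ss) (t ∷ ts) = if s ∧ t then not (oddInter ss ts) else oddInter ss ts

u : ∀ {n} → Ω n → Ω n → ℚ
u S T = if oddInter S T then - 1ℚ else 1ℚ

fourier : (n : ℕ) → Family n → Ω n → ℚ
fourier n C S = 𝔼 n (λ T → 𝟙 C T * u S T)

nonEmpty : ∀ {n} → Ω n → Bool
nonEmpty [] = false
nonEmpty (s ∷ ss) = if s then true else nonEmpty ss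

fourierSum : (n : ℕ) → Family n → Family n → ℚ
fourierSum n A B = sumℚ (allΩ n) (λ S →
  if nonEmpty S
  then (fourier n A S * fourier n A S) * (fourier n B S * fourier n B S)
  else 0ℚ)

module Submission where

-- Write a = 1_A, b = 1_B, N = 2ⁿ, w = 1/N, and let h(x) = Σ_T a(T) b(T ⊕ x) be
-- the overlap of A with B shifted by x.  Fourier analysis on the group
-- ({0,1}ⁿ, ⊕) turns h into the product of the transforms of a and b
-- (convolution theorem), so by Parseval
--     Σ_{S≠∅} Â(S)² B̂(S)² = w⁴ (N Σ h² − (Σ h)²).
-- Monotonicity enters once: for increasing a, b the overlap is largest at
-- zero shift, h(x) ≤ h(∅) = |A ∩ B| =: m₀ (rearrangement inequality, by
-- induction on n).  Hence Σ h² ≤ m₀ Σ h, and, summing h ≤ m₀, Harris'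
-- inequality E ≤ m for m = μ(A∩B), E = μ(A)μ(B).  Rescaling gives
-- Σ_{S≠∅} Â(S)² B̂(S)² ≤ mE − E², and mE − E² ≤ m − E = Cor(A,B) because
-- (m − E)(1 − E) ≥ 0.

open import Defs
open import Data.Nat using (ℕ)
open import Data.Rational using (ℚ; _*_; _<_; 0ℚ)
open import Data.Product using (Σ; _×_)

open import Data.Bool using (Bool; true; false; if_then_else_; not; _xor_)
open import Data.Bool.Properties
  using (xor-assoc; xor-same; not-distribˡ-xor; not-distribʳ-xor; not-involutive)
open import Data.Nat using (zero; suc)
open import Data.Unit using (tt)
open import Data.List using (List; []; _∷_; map; _++_)
open import Data.Vec using ([]; _∷_)
open import Data.Product using (_,_)
open import Data.Rational using (_+_; _-_; -_; _≤_; 1ℚ; ½; nonNegative)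
import Data.Rational.Properties as ℚP
open import Data.Rational.Solver using (module +-*-Solver)
open +-*-Solver using (solve; _:+_; _:*_; _:-_; _:=_; con)
open import Relation.Binary.PropositionalEquality

*-monoˡ-≤ : ∀ {r p q} → 0ℚ ≤ r → p ≤ q → r * p ≤ r * q
*-monoˡ-≤ {r} 0≤r = ℚP.*-monoˡ-≤-nonNeg r {{nonNegative 0≤r}}

*-nonneg : ∀ {p q} → 0ℚ ≤ p → 0ℚ ≤ q → 0ℚ ≤ p * q
*-nonneg {p} {q} 0≤p 0≤q =
  ℚP.nonNegative⁻¹ (p * q) {{ℚP.nonNeg*nonNeg⇒nonNeg p {{nonNegative 0≤p}} q {{nonNegative 0≤q}}}}

≤⇒0≤- : ∀ {p q} → p ≤ q → 0ℚ ≤ q - p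
≤⇒0≤- {p} {q} p≤q = begin
  0ℚ    ≡⟨ sym (ℚP.+-inverseʳ p) ⟩
  p - p ≤⟨ ℚP.+-monoˡ-≤ (- p) p≤q ⟩
  q - p ∎
  where open ℚP.≤-Reasoning

0≤-⇒≤ : ∀ {p q} → 0ℚ ≤ q - p → p ≤ q
0≤-⇒≤ {p} {q} 0≤q-p = begin
  p            ≡⟨ sym (ℚP.+-identityʳ p) ⟩
  p + 0ℚ       ≤⟨ ℚP.+-monoʳ-≤ p 0≤q-p ⟩
  p + (q - p)  ≡⟨ solve 2 (λ p q → p :+ (q :- p) := q) refl p q ⟩
  q            ∎
  where open ℚP.≤-Reasoning

rearrangement : ∀ {p₀ p₁ q₀ q₁} → p₀ ≤ p₁ → q₀ ≤ q₁ →
  p₀ * q₁ + p₁ * q₀ ≤ p₀ * q₀ + p₁ * q₁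
rearrangement {p₀} {p₁} {q₀} {q₁} p₀≤p₁ q₀≤q₁ = 0≤-⇒≤ (begin
  0ℚ                  ≤⟨ *-nonneg (≤⇒0≤- p₀≤p₁) (≤⇒0≤- q₀≤q₁) ⟩
  (p₁ - p₀) * (q₁ - q₀)
    ≡⟨ solve 4 (λ p₀ p₁ q₀ q₁ → (p₁ :- p₀) :* (q₁ :- q₀)
                 := (p₀ :* q₀ :+ p₁ :* q₁) :- (p₀ :* q₁ :+ p₁ :* q₀)) refl p₀ p₁ q₀ q₁ ⟩
  (p₀ * q₀ + p₁ * q₁) - (p₀ * q₁ + p₁ * q₀) ∎)
  where open ℚP.≤-Reasoning

product-bound : ∀ {m E} → E ≤ m → E ≤ 1ℚ → m * E - E * E ≤ m - E
product-bound {m} {E} E≤m E≤1 = 0≤-⇒≤ (begin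
  0ℚ                  ≤⟨ *-nonneg (≤⇒0≤- E≤m) (≤⇒0≤- E≤1) ⟩
  (m - E) * (1ℚ - E)
    ≡⟨ solve 2 (λ m E → (m :- E) :* (con 1ℚ :- E) := (m :- E) :- (m :* E :- E :* E)) refl m E ⟩
  (m - E) - (m * E - E * E) ∎)
  where open ℚP.≤-Reasoning

module _ {X : Set} where

  sum-cong : (xs : List X) {f g : X → ℚ} → (∀ x → f x ≡ g x) → sumℚ xs f ≡ sumℚ xs g
  sum-cong []       f≡g = refl
  sum-cong (x ∷ xs) f≡g = cong₂ _+_ (f≡g x) (sum-cong xs f≡g)

  sum-zero : (xs : List X) → sumℚ xs (λ _ → 0ℚ) ≡ 0ℚ
  sum-zero []       = refl
  sum-zero (x ∷ xs) = trans (ℚP.+-identityˡ _) (sum-zero xs)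

  sum-+ : (xs : List X) (f g : X → ℚ) → sumℚ xs (λ x → f x + g x) ≡ sumℚ xs f + sumℚ xs g
  sum-+ []       f g = refl
  sum-+ (x ∷ xs) f g rewrite sum-+ xs f g =
    solve 4 (λ a b c d → (a :+ b) :+ (c :+ d) := (a :+ c) :+ (b :+ d))
      refl (f x) (g x) (sumℚ xs f) (sumℚ xs g)

  sum-*ˡ : (xs : List X) (c : ℚ) (f : X → ℚ) → sumℚ xs (λ x → c * f x) ≡ c * sumℚ xs f
  sum-*ˡ []       c f = sym (ℚP.*-zeroʳ c)
  sum-*ˡ (x ∷ xs) c f rewrite sum-*ˡ xs c f = sym (ℚP.*-distribˡ-+ c (f x) (sumℚ xs f))

  sum-*ʳ : (xs : List X) (c : ℚ) (f : X → ℚ) → sumℚ xs (λ x → f x * c) ≡ sumℚ xs f * c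
  sum-*ʳ xs c f =
    trans (sum-cong xs (λ x → ℚP.*-comm (f x) c)) (trans (sum-*ˡ xs c f) (ℚP.*-comm c _))

  sum-≤ : (xs : List X) {f g : X → ℚ} → (∀ x → f x ≤ g x) → sumℚ xs f ≤ sumℚ xs g
  sum-≤ []       f≤g = ℚP.≤-refl
  sum-≤ (x ∷ xs) f≤g = ℚP.+-mono-≤ (f≤g x) (sum-≤ xs f≤g)

  sum-nonneg : (xs : List X) {f : X → ℚ} → (∀ x → 0ℚ ≤ f x) → 0ℚ ≤ sumℚ xs f
  sum-nonneg xs 0≤f = ℚP.≤-trans (ℚP.≤-reflexive (sym (sum-zero xs))) (sum-≤ xs 0≤f)

  sum-++ : (xs ys : List X) (f : X → ℚ) → sumℚ (xs ++ ys) f ≡ sumℚ xs f + sumℚ ys f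
  sum-++ []       ys f = sym (ℚP.+-identityˡ _)
  sum-++ (x ∷ xs) ys f rewrite sum-++ xs ys f = sym (ℚP.+-assoc (f x) _ _)

sum-map : ∀ {X Y : Set} (g : X → Y) (xs : List X) (f : Y → ℚ) →
  sumℚ (map g xs) f ≡ sumℚ xs (λ x → f (g x))
sum-map g []       f = refl
sum-map g (x ∷ xs) f = cong (f (g x) +_) (sum-map g xs f)

sum-product : ∀ {X Y : Set} (xs : List X) (ys : List Y) (f : X → ℚ) (g : Y → ℚ) →
  sumℚ xs f * sumℚ ys g ≡ sumℚ xs (λ x → sumℚ ys (λ y → f x * g y))
sum-product xs ys f g =
  trans (sym (sum-*ʳ xs (sumℚ ys g) f)) (sum-cong xs (λ x → sym (sum-*ˡ ys (f x) g)))

sum-swap : ∀ {X Y : Set} (xs : List X) (ys : List Y) (f : X → Y → ℚ) →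
  sumℚ xs (λ x → sumℚ ys (f x)) ≡ sumℚ ys (λ y → sumℚ xs (λ x → f x y))
sum-swap []       ys f = sym (sum-zero ys)
sum-swap (x ∷ xs) ys f rewrite sum-swap xs ys f =
  sym (sum-+ ys (f x) (λ y → sumℚ xs (λ x → f x y)))

∑ : (n : ℕ) → (Ω n → ℚ) → ℚ
∑ n f = sumℚ (allΩ n) f

∑-split : ∀ n (f : Ω (suc n) → ℚ) →
  ∑ (suc n) f ≡ ∑ n (λ T → f (false ∷ T)) + ∑ n (λ T → f (true ∷ T))
∑-split n f =
  trans (sum-++ (map (false ∷_) (allΩ n)) _ f)
        (cong₂ _+_ (sum-map _ (allΩ n) f) (sum-map _ (allΩ n) f))

size : ℕ → ℚ
size n = ∑ n (λ _ → 1ℚ)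

half^-size : ∀ n → half^ n * size n ≡ 1ℚ
half^-size zero    = refl
half^-size (suc n) = begin
  half^ (suc n) * size (suc n)     ≡⟨ cong (half^ (suc n) *_) (∑-split n (λ _ → 1ℚ)) ⟩
  (½ * half^ n) * (size n + size n)
    ≡⟨ solve 3 (λ h w N → (h :* w) :* (N :+ N) := (h :+ h) :* (w :* N)) refl ½ (half^ n) (size n) ⟩
  (½ + ½) * (half^ n * size n)     ≡⟨ cong ((½ + ½) *_) (half^-size n) ⟩
  1ℚ                                ∎
  where open ≡-Reasoning

half^-nonneg : ∀ n → 0ℚ ≤ half^ n
half^-nonneg zero    = ℚP.≤ᵇ⇒≤ tt
half^-nonneg (suc n) = *-nonneg {½} (ℚP.≤ᵇ⇒≤ tt) (half^-nonneg n)

∑-≤-const : ∀ n {f : Ω n → ℚ} (M : ℚ) → (∀ x → f x ≤ M) → ∑ n f ≤ size n * M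
∑-≤-const n {f} M f≤M = begin
  ∑ n f                   ≤⟨ sum-≤ (allΩ n) f≤M ⟩
  ∑ n (λ _ → M)           ≡⟨ sum-cong (allΩ n) (λ _ → sym (ℚP.*-identityʳ M)) ⟩
  ∑ n (λ _ → M * 1ℚ)      ≡⟨ sum-*ˡ (allΩ n) M (λ _ → 1ℚ) ⟩
  M * size n              ≡⟨ ℚP.*-comm M (size n) ⟩
  size n * M              ∎
  where open ℚP.≤-Reasoning

_⊕_ : ∀ {n} → Ω n → Ω n → Ω n
[]       ⊕ []       = []
(a ∷ as) ⊕ (b ∷ bs) = (a xor b) ∷ (as ⊕ bs)

∅ : ∀ {n} → Ω n
∅ {zero}  = []
∅ {suc n} = false ∷ ∅

⊕-cancel : ∀ {n} (t x : Ω n) → t ⊕ (t ⊕ x) ≡ x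
⊕-cancel []      []      = refl
⊕-cancel (t ∷ T) (x ∷ X) =
  cong₂ _∷_ (trans (sym (xor-assoc t t x)) (cong (_xor x) (xor-same t))) (⊕-cancel T X)

translate : ∀ n (f : Ω n → ℚ) (t : Ω n) → ∑ n (λ x → f (t ⊕ x)) ≡ ∑ n f
translate zero    f []        = refl
translate (suc n) f (false ∷ t) = begin
  ∑ (suc n) (λ x → f ((false ∷ t) ⊕ x))
    ≡⟨ ∑-split n (λ x → f ((false ∷ t) ⊕ x)) ⟩
  ∑ n (λ x → f (false ∷ (t ⊕ x))) + ∑ n (λ x → f (true ∷ (t ⊕ x)))
    ≡⟨ cong₂ _+_ (translate n (λ x → f (false ∷ x)) t) (translate n (λ x → f (true ∷ x)) t) ⟩
  ∑ n (λ x → f (false ∷ x)) + ∑ n (λ x → f (true ∷ x))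
    ≡⟨ sym (∑-split n f) ⟩
  ∑ (suc n) f ∎
  where open ≡-Reasoning
translate (suc n) f (true ∷ t) = begin
  ∑ (suc n) (λ x → f ((true ∷ t) ⊕ x))
    ≡⟨ ∑-split n (λ x → f ((true ∷ t) ⊕ x)) ⟩
  ∑ n (λ x → f (true ∷ (t ⊕ x))) + ∑ n (λ x → f (false ∷ (t ⊕ x)))
    ≡⟨ cong₂ _+_ (translate n (λ x → f (true ∷ x)) t) (translate n (λ x → f (false ∷ x)) t) ⟩
  ∑ n (λ x → f (true ∷ x)) + ∑ n (λ x → f (false ∷ x))
    ≡⟨ ℚP.+-comm (∑ n (λ x → f (true ∷ x))) (∑ n (λ x → f (false ∷ x))) ⟩
  ∑ n (λ x → f (false ∷ x)) + ∑ n (λ x → f (true ∷ x))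
    ≡⟨ sym (∑-split n f) ⟩
  ∑ (suc n) f ∎
  where open ≡-Reasoning

sign : Bool → ℚ
sign b = if b then - 1ℚ else 1ℚ

sign-xor : ∀ p q → sign (p xor q) ≡ sign p * sign q
sign-xor false false = refl
sign-xor false true  = refl
sign-xor true  false = refl
sign-xor true  true  = refl

sign-not : ∀ p → sign (not p) ≡ - sign p
sign-not false = refl
sign-not true  = refl

oddInter-⊕ : ∀ {n} (S x y : Ω n) → oddInter S (x ⊕ y) ≡ oddInter S x xor oddInter S y
oddInter-⊕ []          []      []      = refl
oddInter-⊕ (false ∷ S) (a ∷ x) (b ∷ y) = oddInter-⊕ S x y
oddInter-⊕ (true ∷ S)  (a ∷ x) (b ∷ y) rewrite oddInter-⊕ S x y =
  flip-xor a b (oddInter S x) (oddInter S y)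
  where
  flip-xor : ∀ a b p q → (if a xor b then not (p xor q) else p xor q)
                          ≡ (if a then not p else p) xor (if b then not q else q)
  flip-xor false false p q = refl
  flip-xor false true  p q = not-distribʳ-xor p q
  flip-xor true  false p q = not-distribˡ-xor p q
  flip-xor true  true  p q = sym (begin
    not p xor not q      ≡⟨ sym (not-distribˡ-xor p (not q)) ⟩
    not (p xor not q)    ≡⟨ cong not (sym (not-distribʳ-xor p q)) ⟩
    not (not (p xor q))  ≡⟨ not-involutive _ ⟩
    p xor q              ∎)
    where open ≡-Reasoning

u-⊕ : ∀ {n} (S x y : Ω n) → u S (x ⊕ y) ≡ u S x * u S y
u-⊕ S x y = trans (cong sign (oddInter-⊕ S x y)) (sign-xor (oddInter S x) (oddInter S y))

u-∅ : ∀ {n} (T : Ω n) → u ∅ T ≡ 1ℚ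
u-∅ []      = refl
u-∅ (t ∷ T) = u-∅ T

δ : ∀ {n} → Ω n → ℚ
δ z = if nonEmpty z then 0ℚ else 1ℚ

∑-times-zero : ∀ n (g : Ω n → ℚ) → ∑ n (λ y → g y * 0ℚ) ≡ 0ℚ
∑-times-zero n g = trans (sum-cong (allΩ n) (λ y → ℚP.*-zeroʳ (g y))) (sum-zero (allΩ n))

orthogonality : ∀ n (z : Ω n) → ∑ n (λ S → u S z) ≡ size n * δ z
orthogonality zero    []          = refl
orthogonality (suc n) (false ∷ z) = begin
  ∑ (suc n) (λ S → u S (false ∷ z))   ≡⟨ ∑-split n (λ S → u S (false ∷ z)) ⟩
  ∑ n (λ S → u S z) + ∑ n (λ S → u S z)
    ≡⟨ cong₂ _+_ (orthogonality n z) (orthogonality n z) ⟩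
  size n * δ z + size n * δ z         ≡⟨ sym (ℚP.*-distribʳ-+ (δ z) (size n) (size n)) ⟩
  (size n + size n) * δ z              ≡⟨ cong (_* δ z) (sym (∑-split n (λ _ → 1ℚ))) ⟩
  size (suc n) * δ z                   ∎
  where open ≡-Reasoning
orthogonality (suc n) (true ∷ z) = begin
  ∑ (suc n) (λ S → u S (true ∷ z))    ≡⟨ ∑-split n (λ S → u S (true ∷ z)) ⟩
  ∑ n (λ S → u S z) + ∑ n (λ S → sign (not (oddInter S z)))
    ≡⟨ cong (∑ n (λ S → u S z) +_) (sum-cong (allΩ n) (λ S → sign-not (oddInter S z))) ⟩
  ∑ n (λ S → u S z) + ∑ n (λ S → - u S z)
    ≡⟨ sym (sum-+ (allΩ n) (λ S → u S z) (λ S → - u S z)) ⟩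
  ∑ n (λ S → u S z - u S z)            ≡⟨ sum-cong (allΩ n) (λ S → ℚP.+-inverseʳ (u S z)) ⟩
  ∑ n (λ _ → 0ℚ)                      ≡⟨ sum-zero (allΩ n) ⟩
  0ℚ                                   ≡⟨ sym (ℚP.*-zeroʳ (size (suc n))) ⟩
  size (suc n) * 0ℚ                    ∎
  where open ≡-Reasoning

sift : ∀ n (g : Ω n → ℚ) (x : Ω n) → ∑ n (λ y → g y * δ (x ⊕ y)) ≡ g x
sift zero    g []          = trans (ℚP.+-identityʳ _) (ℚP.*-identityʳ (g []))
sift (suc n) g (false ∷ x) =
  trans (∑-split n (λ y → g y * δ ((false ∷ x) ⊕ y)))
        (trans (cong₂ _+_ (sift n (λ y → g (false ∷ y)) x) (∑-times-zero n (λ y → g (true ∷ y))))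
               (ℚP.+-identityʳ _))
sift (suc n) g (true ∷ x)  =
  trans (∑-split n (λ y → g y * δ ((true ∷ x) ⊕ y)))
        (trans (cong₂ _+_ (∑-times-zero n (λ y → g (false ∷ y))) (sift n (λ y → g (true ∷ y)) x))
               (ℚP.+-identityˡ _))

-- Unnormalised Fourier coefficient: fourier n C S ≡ half^ n * walsh n (𝟙 C) S.
walsh : ∀ n → (Ω n → ℚ) → Ω n → ℚ
walsh n f S = ∑ n (λ T → f T * u S T)

walsh-∅ : ∀ n (f : Ω n → ℚ) → walsh n f ∅ ≡ ∑ n f
walsh-∅ n f = sum-cong (allΩ n) (λ T → trans (cong (f T *_) (u-∅ T)) (ℚP.*-identityʳ (f T)))

walsh-square : ∀ n (f : Ω n → ℚ) (S : Ω n) →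
  walsh n f S * walsh n f S ≡ ∑ n (λ x → ∑ n (λ y → (f x * f y) * u S (x ⊕ y)))
walsh-square n f S =
  trans (sum-product (allΩ n) (allΩ n) (λ x → f x * u S x) (λ y → f y * u S y))
        (sum-cong (allΩ n) (λ x → sum-cong (allΩ n) (λ y → regroup x y)))
  where
  regroup : ∀ x y → (f x * u S x) * (f y * u S y) ≡ (f x * f y) * u S (x ⊕ y)
  regroup x y rewrite u-⊕ S x y =
    solve 4 (λ p q r s → (p :* r) :* (q :* s) := (p :* q) :* (r :* s)) refl (f x) (f y) (u S x) (u S y)

parseval : ∀ n (f : Ω n → ℚ) →
  ∑ n (λ S → walsh n f S * walsh n f S) ≡ size n * ∑ n (λ x → f x * f x)
parseval n f = begin
  ∑ n (λ S → walsh n f S * walsh n f S)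
    ≡⟨ sum-cong L (walsh-square n f) ⟩
  ∑ n (λ S → ∑ n (λ x → ∑ n (λ y → (f x * f y) * u S (x ⊕ y))))
    ≡⟨ sum-swap L L (λ S x → ∑ n (λ y → (f x * f y) * u S (x ⊕ y))) ⟩
  ∑ n (λ x → ∑ n (λ S → ∑ n (λ y → (f x * f y) * u S (x ⊕ y))))
    ≡⟨ sum-cong L (λ x → sum-swap L L (λ S y → (f x * f y) * u S (x ⊕ y))) ⟩
  ∑ n (λ x → ∑ n (λ y → ∑ n (λ S → (f x * f y) * u S (x ⊕ y))))
    ≡⟨ sum-cong L (λ x → sum-cong L (λ y → trans (sum-*ˡ L (f x * f y) (λ S → u S (x ⊕ y)))
                                                (cong ((f x * f y) *_) (orthogonality n (x ⊕ y))))) ⟩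
  ∑ n (λ x → ∑ n (λ y → (f x * f y) * (size n * δ (x ⊕ y))))
    ≡⟨ sum-cong L (λ x → trans (sum-cong L (λ y → regroup (f x) (f y) (δ (x ⊕ y))))
                               (trans (sum-*ˡ L (size n * f x) (λ y → f y * δ (x ⊕ y)))
                                      (cong ((size n * f x) *_) (sift n f x)))) ⟩
  ∑ n (λ x → (size n * f x) * f x)
    ≡⟨ sum-cong L (λ x → ℚP.*-assoc (size n) (f x) (f x)) ⟩
  ∑ n (λ x → size n * (f x * f x))
    ≡⟨ sum-*ˡ L (size n) (λ x → f x * f x) ⟩
  size n * ∑ n (λ x → f x * f x) ∎
  where
  open ≡-Reasoning
  L : List (Ω n)
  L = allΩ n
  regroup : ∀ p q d → (p * q) * (size n * d) ≡ (size n * p) * (q * d)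
  regroup p q d = solve 4 (λ p q N d → (p :* q) :* (N :* d) := (N :* p) :* (q :* d)) refl p q (size n) d

∑-nonEmpty : ∀ n (g : Ω n → ℚ) →
  ∑ n (λ S → if nonEmpty S then g S else 0ℚ) + g ∅ ≡ ∑ n g
∑-nonEmpty zero    g = solve 1 (λ a → (con 0ℚ :+ con 0ℚ) :+ a := a :+ con 0ℚ) refl (g [])
∑-nonEmpty (suc n) g = begin
  ∑ (suc n) (λ S → if nonEmpty S then g S else 0ℚ) + g ∅
    ≡⟨ cong (_+ g ∅) (∑-split n (λ S → if nonEmpty S then g S else 0ℚ)) ⟩
  (X + ∑ n g₁) + g ∅
    ≡⟨ solve 3 (λ a b c → (a :+ b) :+ c := (a :+ c) :+ b) refl X (∑ n g₁) (g ∅) ⟩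
  (X + g ∅) + ∑ n g₁
    ≡⟨ cong (_+ ∑ n g₁) (∑-nonEmpty n (λ T → g (false ∷ T))) ⟩
  ∑ n (λ T → g (false ∷ T)) + ∑ n g₁
    ≡⟨ sym (∑-split n g) ⟩
  ∑ (suc n) g ∎
  where
  open ≡-Reasoning
  g₁ : Ω n → ℚ
  g₁ T = g (true ∷ T)
  X : ℚ
  X = ∑ n (λ S → if nonEmpty S then g (false ∷ S) else 0ℚ)

parseval-nonEmpty : ∀ n (f : Ω n → ℚ) →
  ∑ n (λ S → if nonEmpty S then walsh n f S * walsh n f S else 0ℚ)
    ≡ size n * ∑ n (λ x → f x * f x) - ∑ n f * ∑ n f
parseval-nonEmpty n f = begin
  X                    ≡⟨ solve 2 (λ X c → X := (X :+ c) :- c) refl X (W ∅ * W ∅) ⟩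
  (X + W ∅ * W ∅) - W ∅ * W ∅
    ≡⟨ cong₂ (λ p q → p - q * q) (∑-nonEmpty n (λ S → W S * W S)) (walsh-∅ n f) ⟩
  ∑ n (λ S → W S * W S) - ∑ n f * ∑ n f
    ≡⟨ cong (_- ∑ n f * ∑ n f) (parseval n f) ⟩
  size n * ∑ n (λ x → f x * f x) - ∑ n f * ∑ n f ∎
  where
  open ≡-Reasoning
  W : Ω n → ℚ
  W = walsh n f
  X : ℚ
  X = ∑ n (λ S → if nonEmpty S then W S * W S else 0ℚ)

-- shiftOverlap a b x = Σ_T a(T) b(T ⊕ x); for indicators, |A ∩ (B ⊕ x)|.
shiftOverlap : ∀ n → (Ω n → ℚ) → (Ω n → ℚ) → Ω n → ℚ
shiftOverlap n a b x = ∑ n (λ T → a T * b (T ⊕ x))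

walsh-overlap : ∀ n (a b : Ω n → ℚ) (S : Ω n) →
  walsh n (shiftOverlap n a b) S ≡ walsh n a S * walsh n b S
walsh-overlap n a b S = begin
  ∑ n (λ x → shiftOverlap n a b x * u S x)
    ≡⟨ sum-cong L (λ x → sym (sum-*ʳ L (u S x) (λ T → a T * b (T ⊕ x)))) ⟩
  ∑ n (λ x → ∑ n (λ T → (a T * b (T ⊕ x)) * u S x))
    ≡⟨ sum-swap L L (λ x T → (a T * b (T ⊕ x)) * u S x) ⟩
  ∑ n (λ T → ∑ n (λ x → (a T * b (T ⊕ x)) * u S x))
    ≡⟨ sum-cong L (λ T → trans (sum-cong L (λ x → ℚP.*-assoc (a T) _ _))
                               (sum-*ˡ L (a T) (λ x → b (T ⊕ x) * u S x))) ⟩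
  ∑ n (λ T → a T * ∑ n (λ x → b (T ⊕ x) * u S x))
    ≡⟨ sum-cong L (λ T → cong (a T *_) (shifted T)) ⟩
  ∑ n (λ T → a T * (u S T * walsh n b S))
    ≡⟨ sum-cong L (λ T → sym (ℚP.*-assoc (a T) (u S T) (walsh n b S))) ⟩
  ∑ n (λ T → (a T * u S T) * walsh n b S)
    ≡⟨ sum-*ʳ L (walsh n b S) (λ T → a T * u S T) ⟩
  walsh n a S * walsh n b S ∎
  where
  open ≡-Reasoning
  L : List (Ω n)
  L = allΩ n
  -- substituting y = T ⊕ x in the inner sum
  shifted : ∀ T → ∑ n (λ x → b (T ⊕ x) * u S x) ≡ u S T * walsh n b S
  shifted T = begin
    ∑ n (λ x → b (T ⊕ x) * u S x)
      ≡⟨ sum-cong L (λ x → cong (λ z → b (T ⊕ x) * u S z) (sym (⊕-cancel T x))) ⟩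
    ∑ n (λ x → b (T ⊕ x) * u S (T ⊕ (T ⊕ x)))
      ≡⟨ translate n (λ y → b y * u S (T ⊕ y)) T ⟩
    ∑ n (λ y → b y * u S (T ⊕ y))
      ≡⟨ sum-cong L (λ y → cong (b y *_) (u-⊕ S T y)) ⟩
    ∑ n (λ y → b y * (u S T * u S y))
      ≡⟨ sum-cong L (λ y → solve 3 (λ p q r → p :* (q :* r) := q :* (p :* r)) refl (b y) (u S T) (u S y)) ⟩
    ∑ n (λ y → u S T * (b y * u S y))
      ≡⟨ sum-*ˡ L (u S T) (λ y → b y * u S y) ⟩
    u S T * walsh n b S ∎

∑-overlap : ∀ n (a b : Ω n → ℚ) → ∑ n (shiftOverlap n a b) ≡ ∑ n a * ∑ n b
∑-overlap n a b = begin
  ∑ n (shiftOverlap n a b)          ≡⟨ sym (walsh-∅ n (shiftOverlap n a b)) ⟩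
  walsh n (shiftOverlap n a b) ∅    ≡⟨ walsh-overlap n a b ∅ ⟩
  walsh n a ∅ * walsh n b ∅    ≡⟨ cong₂ _*_ (walsh-∅ n a) (walsh-∅ n b) ⟩
  ∑ n a * ∑ n b                ∎
  where open ≡-Reasoning

overlap-nonneg : ∀ n {a b : Ω n → ℚ} → (∀ x → 0ℚ ≤ a x) → (∀ x → 0ℚ ≤ b x) →
  ∀ x → 0ℚ ≤ shiftOverlap n a b x
overlap-nonneg n 0≤a 0≤b x = sum-nonneg (allΩ n) (λ T → *-nonneg (0≤a T) (0≤b (T ⊕ x)))

fourierSum-overlap : ∀ n (A B : Family n) →
  let w = half^ n ; h = shiftOverlap n (𝟙 A) (𝟙 B) in
  fourierSum n A B ≡ ((w * w) * (w * w)) * (size n * ∑ n (λ x → h x * h x) - ∑ n h * ∑ n h)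
fourierSum-overlap n A B = begin
  fourierSum n A B
    ≡⟨ sum-cong (allΩ n) term ⟩
  ∑ n (λ S → w⁴ * (if nonEmpty S then walsh n h S * walsh n h S else 0ℚ))
    ≡⟨ sum-*ˡ (allΩ n) w⁴ _ ⟩
  w⁴ * ∑ n (λ S → if nonEmpty S then walsh n h S * walsh n h S else 0ℚ)
    ≡⟨ cong (w⁴ *_) (parseval-nonEmpty n h) ⟩
  w⁴ * (size n * ∑ n (λ x → h x * h x) - ∑ n h * ∑ n h) ∎
  where
  open ≡-Reasoning
  w : ℚ
  w = half^ n
  w⁴ : ℚ
  w⁴ = (w * w) * (w * w)
  a : Ω n → ℚ
  a = 𝟙 A
  b : Ω n → ℚ
  b = 𝟙 B
  h : Ω n → ℚ
  h = shiftOverlap n a b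
  term : ∀ S → (if nonEmpty S
                then (fourier n A S * fourier n A S) * (fourier n B S * fourier n B S)
                else 0ℚ)
             ≡ w⁴ * (if nonEmpty S then walsh n h S * walsh n h S else 0ℚ)
  term S with nonEmpty S
  ... | false = sym (ℚP.*-zeroʳ w⁴)
  ... | true  = begin
    ((w * α) * (w * α)) * ((w * β) * (w * β))
      ≡⟨ solve 3 (λ w α β → ((w :* α) :* (w :* α)) :* ((w :* β) :* (w :* β))
                   := ((w :* w) :* (w :* w)) :* ((α :* β) :* (α :* β))) refl w α β ⟩
    w⁴ * ((α * β) * (α * β))
      ≡⟨ cong (λ z → w⁴ * (z * z)) (sym (walsh-overlap n a b S)) ⟩
    w⁴ * (walsh n h S * walsh n h S) ∎
    where
    α : ℚ
    α = walsh n a S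
    β : ℚ
    β = walsh n b S

Monotone : ∀ {n} → (Ω n → ℚ) → Set
Monotone {n} f = ∀ x y → x ⊆ y → f x ≤ f y

⊆-refl : ∀ {n} (T : Ω n) → T ⊆ T
⊆-refl []          = tt
⊆-refl (false ∷ T) = ⊆-refl T
⊆-refl (true ∷ T)  = ⊆-refl T

section : ∀ {n} → (Ω (suc n) → ℚ) → Bool → Ω n → ℚ
section f c T = f (c ∷ T)

section-monotone : ∀ {n} {f : Ω (suc n) → ℚ} (c : Bool) → Monotone f → Monotone (section f c)
section-monotone false mono x y x⊆y = mono (false ∷ x) (false ∷ y) x⊆y
section-monotone true  mono x y x⊆y = mono (true ∷ x) (true ∷ y) x⊆y

section-≤ : ∀ {n} {f : Ω (suc n) → ℚ} → Monotone f → ∀ x → section f false x ≤ section f true x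
section-≤ mono x = mono (false ∷ x) (true ∷ x) (⊆-refl x)

-- Induction on n, splitting off the first coordinate; a shift
-- in that coordinate pairs the 0-section of a with the 1-section of b, which
-- the rearrangement inequality undoes.
overlap-≤ : ∀ n {a b : Ω n → ℚ} → Monotone a → Monotone b →
  ∀ x → shiftOverlap n a b x ≤ ∑ n (λ T → a T * b T)
overlap-≤ zero    monoA monoB []          = ℚP.≤-refl
overlap-≤ (suc n) {a} {b} monoA monoB (false ∷ x) = begin
  shiftOverlap (suc n) a b (false ∷ x)
    ≡⟨ ∑-split n (λ T → a T * b (T ⊕ (false ∷ x))) ⟩
  shiftOverlap n a₀ b₀ x + shiftOverlap n a₁ b₁ x
    ≤⟨ ℚP.+-mono-≤ (overlap-≤ n (section-monotone false monoA) (section-monotone false monoB) x)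
                   (overlap-≤ n (section-monotone true monoA) (section-monotone true monoB) x) ⟩
  ∑ n (λ T → a₀ T * b₀ T) + ∑ n (λ T → a₁ T * b₁ T)
    ≡⟨ sym (∑-split n (λ T → a T * b T)) ⟩
  ∑ (suc n) (λ T → a T * b T) ∎
  where
  open ℚP.≤-Reasoning
  a₀ a₁ b₀ b₁ : Ω n → ℚ
  a₀ = section a false
  a₁ = section a true
  b₀ = section b false
  b₁ = section b true
overlap-≤ (suc n) {a} {b} monoA monoB (true ∷ x) = begin
  shiftOverlap (suc n) a b (true ∷ x)
    ≡⟨ ∑-split n (λ T → a T * b (T ⊕ (true ∷ x))) ⟩
  shiftOverlap n a₀ b₁ x + shiftOverlap n a₁ b₀ x
    ≤⟨ ℚP.+-mono-≤ (overlap-≤ n (section-monotone false monoA) (section-monotone true monoB) x)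
                   (overlap-≤ n (section-monotone true monoA) (section-monotone false monoB) x) ⟩
  ∑ n (λ T → a₀ T * b₁ T) + ∑ n (λ T → a₁ T * b₀ T)
    ≡⟨ sym (sum-+ (allΩ n) (λ T → a₀ T * b₁ T) (λ T → a₁ T * b₀ T)) ⟩
  ∑ n (λ T → a₀ T * b₁ T + a₁ T * b₀ T)
    ≤⟨ sum-≤ (allΩ n) (λ T → rearrangement (section-≤ monoA T) (section-≤ monoB T)) ⟩
  ∑ n (λ T → a₀ T * b₀ T + a₁ T * b₁ T)
    ≡⟨ sum-+ (allΩ n) (λ T → a₀ T * b₀ T) (λ T → a₁ T * b₁ T) ⟩
  ∑ n (λ T → a₀ T * b₀ T) + ∑ n (λ T → a₁ T * b₁ T)
    ≡⟨ sym (∑-split n (λ T → a T * b T)) ⟩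
  ∑ (suc n) (λ T → a T * b T) ∎
  where
  open ℚP.≤-Reasoning
  a₀ a₁ b₀ b₁ : Ω n → ℚ
  a₀ = section a false
  a₁ = section a true
  b₀ = section b false
  b₁ = section b true

𝟙-nonneg : ∀ {n} (C : Family n) x → 0ℚ ≤ 𝟙 C x
𝟙-nonneg C x with C x
... | false = ℚP.≤-refl
... | true  = ℚP.≤ᵇ⇒≤ tt

𝟙-≤-1 : ∀ {n} (C : Family n) x → 𝟙 C x ≤ 1ℚ
𝟙-≤-1 C x with C x
... | false = ℚP.≤ᵇ⇒≤ tt
... | true  = ℚP.≤-refl

𝟙-∩ : ∀ {n} (A B : Family n) x → 𝟙 (A ∩ B) x ≡ 𝟙 A x * 𝟙 B x
𝟙-∩ A B x with A x | B x
... | false | false = refl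
... | false | true  = refl
... | true  | false = refl
... | true  | true  = refl

𝟙-monotone : ∀ {n} {C : Family n} → Increasing C → Monotone (𝟙 C)
𝟙-monotone {C = C} inc x y x⊆y with C x in Cx
... | false = 𝟙-nonneg C y
... | true rewrite inc x y x⊆y Cx = ℚP.≤-refl

μ-≤-1 : ∀ n (C : Family n) → μ n C ≤ 1ℚ
μ-≤-1 n C = begin
  half^ n * ∑ n (𝟙 C)          ≤⟨ *-monoˡ-≤ (half^-nonneg n) (∑-≤-const n 1ℚ (𝟙-≤-1 C)) ⟩
  half^ n * (size n * 1ℚ)      ≡⟨ cong (half^ n *_) (ℚP.*-identityʳ (size n)) ⟩
  half^ n * size n             ≡⟨ half^-size n ⟩
  1ℚ                           ∎
  where open ℚP.≤-Reasoning

μ-product-≤-1 : ∀ n (A B : Family n) → μ n A * μ n B ≤ 1ℚ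
μ-product-≤-1 n A B = begin
  μ n A * μ n B   ≤⟨ *-monoˡ-≤ (*-nonneg (half^-nonneg n) (sum-nonneg (allΩ n) (𝟙-nonneg A)))
                               (μ-≤-1 n B) ⟩
  μ n A * 1ℚ      ≡⟨ ℚP.*-identityʳ (μ n A) ⟩
  μ n A           ≤⟨ μ-≤-1 n A ⟩
  1ℚ              ∎
  where open ℚP.≤-Reasoning

μ-∩ : ∀ n (A B : Family n) → μ n (A ∩ B) ≡ half^ n * ∑ n (λ T → 𝟙 A T * 𝟙 B T)
μ-∩ n A B = cong (half^ n *_) (sum-cong (allΩ n) (𝟙-∩ A B))

μ-product : ∀ n (A B : Family n) →
  μ n A * μ n B ≡ (half^ n * half^ n) * ∑ n (shiftOverlap n (𝟙 A) (𝟙 B))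
μ-product n A B = begin
  (w * ∑ n (𝟙 A)) * (w * ∑ n (𝟙 B))
    ≡⟨ solve 3 (λ w p q → (w :* p) :* (w :* q) := (w :* w) :* (p :* q)) refl w (∑ n (𝟙 A)) (∑ n (𝟙 B)) ⟩
  (w * w) * (∑ n (𝟙 A) * ∑ n (𝟙 B))
    ≡⟨ cong ((w * w) *_) (sym (∑-overlap n (𝟙 A) (𝟙 B))) ⟩
  (w * w) * ∑ n (shiftOverlap n (𝟙 A) (𝟙 B)) ∎
  where
  open ≡-Reasoning
  w : ℚ
  w = half^ n

-- Harris' inequality μ(A)μ(B) ≤ μ(A ∩ B), obtained by summing the shift inequality.
harris : ∀ n (A B : Family n) → Increasing A → Increasing B → μ n A * μ n B ≤ μ n (A ∩ B)
harris n A B incA incB = begin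
  μ n A * μ n B                 ≡⟨ μ-product n A B ⟩
  (w * w) * ∑ n (shiftOverlap n a b)
    ≤⟨ *-monoˡ-≤ (*-nonneg (half^-nonneg n) (half^-nonneg n))
         (∑-≤-const n m₀ (overlap-≤ n (𝟙-monotone incA) (𝟙-monotone incB))) ⟩
  (w * w) * (size n * m₀)
    ≡⟨ solve 3 (λ w N m → (w :* w) :* (N :* m) := (w :* N) :* (w :* m)) refl w (size n) m₀ ⟩
  (w * size n) * (w * m₀)       ≡⟨ cong (_* (w * m₀)) (half^-size n) ⟩
  1ℚ * (w * m₀)                 ≡⟨ ℚP.*-identityˡ (w * m₀) ⟩
  w * m₀                        ≡⟨ sym (μ-∩ n A B) ⟩
  μ n (A ∩ B)                   ∎
  where
  open ℚP.≤-Reasoning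
  w : ℚ
  w = half^ n
  a : Ω n → ℚ
  a = 𝟙 A
  b : Ω n → ℚ
  b = 𝟙 B
  m₀ : ℚ
  m₀ = ∑ n (λ T → a T * b T)

∑-square-≤ : ∀ n {f : Ω n → ℚ} (M : ℚ) → (∀ x → 0ℚ ≤ f x) → (∀ x → f x ≤ M) →
  ∑ n (λ x → f x * f x) ≤ M * ∑ n f
∑-square-≤ n {f} M 0≤f f≤M = begin
  ∑ n (λ x → f x * f x)  ≤⟨ sum-≤ (allΩ n) (λ x → ℚP.≤-trans (*-monoˡ-≤ (0≤f x) (f≤M x))
                                                           (ℚP.≤-reflexive (ℚP.*-comm (f x) M))) ⟩
  ∑ n (λ x → M * f x)    ≡⟨ sum-*ˡ (allΩ n) M f ⟩
  M * ∑ n f              ∎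
  where open ℚP.≤-Reasoning

rescale : ∀ {w N K M s} → w * N ≡ 1ℚ → 0ℚ ≤ w → K ≤ M * s →
  ((w * w) * (w * w)) * (N * K - s * s) ≤ (w * M) * ((w * w) * s) - ((w * w) * s) * ((w * w) * s)
rescale {w} {N} {K} {M} {s} wN≡1 0≤w K≤Ms = begin
  ((w * w) * (w * w)) * (N * K - s * s)
    ≡⟨ solve 4 (λ w N K s → ((w :* w) :* (w :* w)) :* (N :* K :- s :* s)
                 := (w :* N) :* (((w :* w) :* w) :* K) :- ((w :* w) :* s) :* ((w :* w) :* s))
         refl w N K s ⟩
  (w * N) * (w³ * K) - E * E     ≡⟨ cong (λ z → z * (w³ * K) - E * E) wN≡1 ⟩
  1ℚ * (w³ * K) - E * E          ≡⟨ cong (_- E * E) (ℚP.*-identityˡ (w³ * K)) ⟩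
  w³ * K - E * E
    ≤⟨ ℚP.+-monoˡ-≤ (- (E * E)) (*-monoˡ-≤ (*-nonneg (*-nonneg 0≤w 0≤w) 0≤w) K≤Ms) ⟩
  w³ * (M * s) - E * E
    ≡⟨ cong (_- E * E) (solve 3 (λ w M s → ((w :* w) :* w) :* (M :* s) := (w :* M) :* ((w :* w) :* s)) refl w M s) ⟩
  (w * M) * E - E * E ∎
  where
  open ℚP.≤-Reasoning
  w³ : ℚ
  w³ = (w * w) * w
  E : ℚ
  E = (w * w) * s

corollary5p6 : Σ ℚ (λ c → (0ℚ < c) × ((n : ℕ) → 1 Data.Nat.≤ n → (A B : Family n) → Increasing A → Increasing B → c * fourierSum n A B Data.Rational.≤ Cor n A B))
corollary5p6 = 1ℚ , ℚP.positive⁻¹ 1ℚ , bound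
  where
  bound : (n : ℕ) → 1 Data.Nat.≤ n → (A B : Family n) → Increasing A → Increasing B →
    1ℚ * fourierSum n A B ≤ Cor n A B
  bound n _ A B incA incB = begin
    1ℚ * fourierSum n A B                                     ≡⟨ ℚP.*-identityˡ _ ⟩
    fourierSum n A B                                          ≡⟨ fourierSum-overlap n A B ⟩
    ((w * w) * (w * w)) * (size n * ∑ n (λ x → h x * h x) - ∑ n h * ∑ n h)
      ≤⟨ rescale (half^-size n) (half^-nonneg n) energy ⟩
    (w * m₀) * ((w * w) * ∑ n h) - ((w * w) * ∑ n h) * ((w * w) * ∑ n h)
      ≡⟨ cong₂ (λ m E → m * E - E * E) (sym (μ-∩ n A B)) (sym (μ-product n A B)) ⟩
    μ n (A ∩ B) * E - E * E
      ≤⟨ product-bound (harris n A B incA incB) (μ-product-≤-1 n A B) ⟩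
    Cor n A B                                                 ∎
    where
    open ℚP.≤-Reasoning
    w : ℚ
    w = half^ n
    h : Ω n → ℚ
    h = shiftOverlap n (𝟙 A) (𝟙 B)
    m₀ : ℚ
    m₀ = ∑ n (λ T → 𝟙 A T * 𝟙 B T)
    E : ℚ
    E = μ n A * μ n B
    energy : ∑ n (λ x → h x * h x) ≤ m₀ * ∑ n h
    energy = ∑-square-≤ n m₀ (overlap-nonneg n (𝟙-nonneg A) (𝟙-nonneg B))
                             (overlap-≤ n (𝟙-monotone incA) (𝟙-monotone incB))
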